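{- Let $r,n,p,q,p',q'$ be positive integers such that $G(r,p,q,n)$ and $G(r,p',q',n)$ are defined (i.e. $p,q,p',q'$ divide $r$, $pq\mid rn$, $p'q'\mid rn$), with $pq=p'q'$ and $\mathrm{GCD}(\frac{rn}{q},p')=\mathrm{GCD}(\frac{rn}{q'},p)$. Then $G(r,p,q,n)\cong G(r,p',q',n)$.
   Context: $G(r,n)$ is the group of $n\times n$ complex matrices with exactly one nonzero entry in each row and column, each an $r$-th root of unity. For $p\mid r$, $G(r,p,n)$ is the subgroup of $A\in G(r,n)$ with $\det A/\det|A|$ an $(r/p)$-th root of unity ($|A|$ the matrix of absolute values). For $q\mid r$, $pq\mid rn$, $G(r,p,q,n)=G(r,p,n)/C_q$ with $C_q=\langle e^{2\pi i/q}I\rangle$. -}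

module Defs where

open import Data.Nat as ℕ using (ℕ; zero; suc; NonZero)
open import Data.Nat.DivMod using (_/_)
open import Data.Integer as ℤ using (ℤ; +_; _+_; _*_; -_; _-_)
open import Data.Integer.Properties as ℤP
open import Data.Integer.Divisibility.Signed using (_∣_; divides; ∣m∣n⇒∣m+n; ∣m⇒∣-m; ∣n⇒∣m*n)
open import Data.Fin using (Fin; zero; suc)
open import Data.Fin.Permutation as Perm using (Permutation′; _⟨$⟩ʳ_; _⟨$⟩ˡ_; _∘ₚ_; flip)
open import Data.Product using (Σ; ∃; _×_; _,_; proj₁; proj₂)
open import Algebra.Bundles.Raw using (RawGroup)
import Level
open import Relation.Binary.PropositionalEquality
  using (_≡_; refl; sym; trans; cong; cong₂; subst)

import Algebra.Properties.CommutativeMonoid.Sum as SumProps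
open SumProps ℤP.+-0-commutativeMonoid using (sum; sum-permute)

-- Model of G(r,n): the monomial matrix with entry ζ_r^(expo i) in position
-- (i , perm i) (and 0 elsewhere), where ζ_r = e^{2πi/r}.  Exponents are
-- integers, read modulo r.
record Mon (n : ℕ) : Set where
  constructor mon
  field
    perm : Permutation′ n
    expo : Fin n → ℤ
open Mon public

-- Matrix product: (σ,a)(τ,b) has entry ζ^(a i + b (σ i)) at (i , τ (σ i)).
_·_ : ∀ {n} → Mon n → Mon n → Mon n
mon σ a · mon τ b = mon (σ ∘ₚ τ) (λ i → a i + b (σ ⟨$⟩ʳ i))

one : ∀ {n} → Mon n
one = mon Perm.id (λ _ → + 0)

inv : ∀ {n} → Mon n → Mon n
inv (mon σ a) = mon (flip σ) (λ i → - a (σ ⟨$⟩ˡ i))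

-- det A / det |A| = ζ_r^(Σ_i expo i); it is an (r/p)-th root of unity iff
-- ζ_r^((r/p) Σ_i expo i) = 1, i.e. r divides (r/p) * Σ_i expo i.
InG : (r p : ℕ) .{{_ : NonZero p}} → ∀ {n} → Mon n → Set
InG r p x = (+ r) ∣ ((+ (r / p)) * sum (expo x))

-- A and B are equal in G(r,n)/C_q iff A = B · (ζ_q^k I) for some integer k,
-- where ζ_q = ζ_r^(r/q).
Cosets : (r q : ℕ) .{{_ : NonZero q}} → ∀ {n} → Mon n → Mon n → Set
Cosets r q x y =
  (∀ i → perm x ⟨$⟩ʳ i ≡ perm y ⟨$⟩ʳ i) ×
  ∃ λ (k : ℤ) → ∀ i → (+ r) ∣ (expo x i - (expo y i + k * (+ (r / q))))

private
  sum-zero : ∀ n → sum {n} (λ _ → + 0) ≡ + 0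
  sum-zero zero = refl
  sum-zero (suc n) = trans (ℤP.+-identityˡ _) (sum-zero n)

  sum-neg : ∀ {n} (f : Fin n → ℤ) → sum (λ i → - f i) ≡ - sum f
  sum-neg {zero} f = refl
  sum-neg {suc n} f =
    trans (cong (_+_ (- f zero)) (sum-neg (λ i → f (suc i))))
          (sym (neg-distrib-+ (f zero) (sum (λ i → f (suc i)))))

  sum-+ : ∀ {n} (f g : Fin n → ℤ) → sum (λ i → f i + g i) ≡ sum f + sum g
  sum-+ {zero} f g = refl
  sum-+ {suc n} f g =
    trans (cong (_+_ (f zero + g zero)) (sum-+ (λ i → f (suc i)) (λ i → g (suc i))))
          (ℤP.+-assoc (f zero) (g zero) _ ⟨trans⟩
            (cong (_+_ (f zero)) (sym (ℤP.+-assoc (g zero) (sum (λ i → f (suc i))) _)) ⟨trans⟩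
            (cong (λ z → f zero + (z + sum (λ i → g (suc i)))) (ℤP.+-comm (g zero) _) ⟨trans⟩
            (cong (_+_ (f zero)) (ℤP.+-assoc (sum (λ i → f (suc i))) (g zero) _) ⟨trans⟩
             sym (ℤP.+-assoc (f zero) _ _)))))
    where
    _⟨trans⟩_ : ∀ {a b c : ℤ} → a ≡ b → b ≡ c → a ≡ c
    _⟨trans⟩_ = trans
    infixr 5 _⟨trans⟩_

  ∣-resp : ∀ {k a b} → a ≡ b → k ∣ a → k ∣ b
  ∣-resp refl d = d

one-in : ∀ r p .{{_ : NonZero p}} n → InG r p (one {n})
one-in r p n = ∣-resp (sym (trans (cong (+ (r / p) *_) (sum-zero n)) (ℤP.*-zeroʳ (+ (r / p)))))
                      (divides (+ 0) refl)

mul-in : ∀ r p .{{_ : NonZero p}} {n} (x y : Mon n) → InG r p x → InG r p y → InG r p (x · y)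
mul-in r p (mon σ a) (mon τ b) ha hb =
  ∣-resp (sym (trans (cong (c *_) (trans (sum-+ a (λ i → b (σ ⟨$⟩ʳ i)))
                                         (cong (_+_ (sum a)) (sym (sum-permute b σ)))))
                     (ℤP.*-distribˡ-+ c (sum a) (sum b))))
         (∣m∣n⇒∣m+n ha hb)
  where c = + (r / p)

inv-in : ∀ r p .{{_ : NonZero p}} {n} (x : Mon n) → InG r p x → InG r p (inv x)
inv-in r p (mon σ a) ha =
  ∣-resp (sym (trans (cong (c *_) (trans (sum-neg (λ i → a (σ ⟨$⟩ˡ i)))
                                         (cong -_ (sym (sum-permute a (flip σ))))))
                     (sym (ℤP.neg-distribʳ-* c (sum a)))))
         (∣m⇒∣-m ha)
  where c = + (r / p)

G : (r n p q : ℕ) .{{_ : NonZero p}} .{{_ : NonZero q}} → RawGroup Level.zero Level.zero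
G r n p q = record
  { Carrier = Σ (Mon n) (InG r p)
  ; _≈_     = λ x y → Cosets r q (proj₁ x) (proj₁ y)
  ; _∙_     = λ x y → (proj₁ x · proj₁ y) , mul-in r p (proj₁ x) (proj₁ y) (proj₂ x) (proj₂ y)
  ; ε       = one , one-in r p n
  ; _⁻¹     = λ x → inv (proj₁ x) , inv-in r p (proj₁ x) (proj₂ x)
  }

-- An element x of G(r,p,n) has exponent sum p·deg(x) for an integer deg(x), and deg
-- is a homomorphism to ℤ.  Since GCD(rn/q, p′) divides p, Bézout gives v, X with
-- p′X = p + (rn/q)v.  Multiplying x by the scalar ζ_r^((r/q)·v·deg(x)) then yields
-- an element with exponent sum p′·X·deg(x), i.e. of G(r,p′,n); because the scalar
-- depends only on deg, this map φ is a homomorphism, and pq = p′q′ makes it carry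
-- C_q-cosets to C_q′-cosets.  The map ψ built in the same way in the other direction
-- satisfies ψ ∘ φ = multiplication by a power of ζ_q (this is where p′q′ ∣ rn is
-- used), and symmetrically, so φ is an isomorphism G(r,p,q,n) ≅ G(r,p′,q′,n).

module Submission where

open import Defs

module Monomial where

  open import Data.Nat as ℕ using (ℕ; NonZero; zero; suc)
  import Data.Nat.Properties as ℕP
  open import Data.Nat.DivMod using (_/_; m/n*n≡m; *-/-assoc; m≥n⇒m/n>0)
  import Data.Nat.Divisibility as ℕ∣
  open ℕ∣ using () renaming (_∣_ to _∣ℕ_)
  open import Data.Nat.GCD using (gcd; gcd-GCD; module Bézout)
  open import Data.Integer as ℤ using (ℤ; +_; 0ℤ; -_; _+_; _-_; _*_)
  import Data.Integer.Properties as ℤP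
  open import Data.Integer.Divisibility.Signed
    using (_∣_; divides; quotient; ∣m∣n⇒∣m+n; ∣m⇒∣-m; *-monoʳ-∣; *-cancelˡ-∣)
  open import Data.Integer.Tactic.RingSolver using (solve)
  open import Data.List using (_∷_; [])
  open import Data.Fin using (Fin; zero; suc)
  open import Data.Fin.Permutation using (_⟨$⟩ʳ_; _⟨$⟩ˡ_; flip)
  open import Data.Product using (Σ; ∃₂; _,_; proj₁; proj₂)
  open import Algebra.Bundles.Raw using (RawGroup)
  open import Algebra.Morphism.Structures using (module GroupMorphisms)
  open import Relation.Binary.Bundles using (Setoid)
  open import Level using (0ℓ)
  open import Relation.Binary.PropositionalEquality
    using (_≡_; refl; sym; trans; cong; cong₂; subst; module ≡-Reasoning)
  open ≡-Reasoning
  open import Algebra.Properties.CommutativeMonoid.Sum ℤP.+-0-commutativeMonoid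
    using (sum; ∑-distrib-+; sum-permute; sum-replicate-zero)

  sum-neg : ∀ {n} (f : Fin n → ℤ) → sum (λ i → - f i) ≡ - sum f
  sum-neg {zero}  f = refl
  sum-neg {suc n} f = begin
    - f zero + sum (λ i → - f (suc i)) ≡⟨ cong (_+_ (- f zero)) (sum-neg (λ i → f (suc i))) ⟩
    - f zero + - sum (λ i → f (suc i)) ≡⟨ ℤP.neg-distrib-+ (f zero) _ ⟨
    - sum f                            ∎

  sum-const : ∀ n (c : ℤ) → sum {n} (λ _ → c) ≡ + n * c
  sum-const zero    c = sym (ℤP.*-zeroˡ c)
  sum-const (suc n) c = trans (cong (_+_ c) (sum-const n c)) (sym (ℤP.suc-* (+ n) c))

  sum-difference : ∀ {n} (f g : Fin n → ℤ) → sum (λ i → f i - g i) ≡ sum f - sum g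
  sum-difference f g = trans (∑-distrib-+ f (λ i → - g i)) (cong (_+_ (sum f)) (sum-neg g))

  ∣-sum : ∀ {n} {k : ℤ} (f : Fin n → ℤ) → (∀ i → k ∣ f i) → k ∣ sum f
  ∣-sum {zero}  f _     = divides 0ℤ refl
  ∣-sum {suc n} f k∣f = ∣m∣n⇒∣m+n (k∣f zero) (∣-sum (λ i → f (suc i)) (λ i → k∣f (suc i)))

  sum-expo-· : ∀ {n} (x y : Mon n) → sum (expo (x · y)) ≡ sum (expo x) + sum (expo y)
  sum-expo-· x y = begin
    sum (λ i → expo x i + expo y (perm x ⟨$⟩ʳ i))     ≡⟨ ∑-distrib-+ (expo x) _ ⟩
    sum (expo x) + sum (λ i → expo y (perm x ⟨$⟩ʳ i)) ≡⟨ cong (_+_ (sum (expo x))) (sum-permute (expo y) (perm x)) ⟨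
    sum (expo x) + sum (expo y)                       ∎

  sum-expo-inv : ∀ {n} (x : Mon n) → sum (expo (inv x)) ≡ - sum (expo x)
  sum-expo-inv x = begin
    sum (λ i → - expo x (perm x ⟨$⟩ˡ i)) ≡⟨ sum-neg (λ i → expo x (perm x ⟨$⟩ˡ i)) ⟩
    - sum (λ i → expo x (perm x ⟨$⟩ˡ i)) ≡⟨ cong -_ (sum-permute (expo x) (flip (perm x))) ⟨
    - sum (expo x)                       ∎

  -- shift c x = ζ_r^c · x
  shift : ∀ {n} → ℤ → Mon n → Mon n
  shift c x = mon (perm x) (λ i → expo x i + c)

  sum-expo-shift : ∀ {n} c (x : Mon n) → sum (expo (shift c x)) ≡ sum (expo x) + + n * c
  sum-expo-shift {n} c x = trans (∑-distrib-+ (expo x) (λ _ → c)) (cong (_+_ (sum (expo x))) (sum-const n c))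

  shift-shift : ∀ {n} c d (x : Mon n) i → expo (shift d (shift c x)) i ≡ expo (shift (c + d) x) i
  shift-shift c d x i = ℤP.+-assoc (expo x i) c d

  shift-· : ∀ {n} c d (x y : Mon n) i → expo (shift (c + d) (x · y)) i ≡ expo (shift c x · shift d y) i
  shift-· c d x y i = interchange (expo x i) (expo y (perm x ⟨$⟩ʳ i)) c d
    where
    interchange : ∀ a b c d → (a + b) + (c + d) ≡ (a + c) + (b + d)
    interchange a b c d = solve (a ∷ b ∷ c ∷ d ∷ [])

  shift-inv : ∀ {n} c (x : Mon n) i → expo (shift (- c) (inv x)) i ≡ expo (inv (shift c x)) i
  shift-inv c x i = sym (ℤP.neg-distrib-+ (expo x (perm x ⟨$⟩ˡ i)) c)

  shift-zero : ∀ {n} (x : Mon n) i → expo (shift 0ℤ x) i ≡ expo x i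
  shift-zero x i = ℤP.+-identityʳ (expo x i)

  module _ {r q : ℕ} .{{_ : NonZero q}} {n : ℕ} where

    private
      D = + (r / q)

    Cosets-intro : ∀ {x y : Mon n} k → (∀ i → perm x ⟨$⟩ʳ i ≡ perm y ⟨$⟩ʳ i) →
                   (∀ i → expo x i ≡ expo y i + k * D) → Cosets r q x y
    Cosets-intro {x} {y} k σ≗τ a≗b+kD = σ≗τ , k , λ i → divides 0ℤ (begin
      expo x i - (expo y i + k * D)             ≡⟨ cong (_- (expo y i + k * D)) (a≗b+kD i) ⟩
      (expo y i + k * D) - (expo y i + k * D)   ≡⟨ ℤP.+-inverseʳ (expo y i + k * D) ⟩
      0ℤ                                        ≡⟨ ℤP.*-zeroˡ (+ r) ⟨
      0ℤ * + r                                  ∎)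

    Cosets-reflexive : ∀ {x y : Mon n} → (∀ i → perm x ⟨$⟩ʳ i ≡ perm y ⟨$⟩ʳ i) →
                       (∀ i → expo x i ≡ expo y i) → Cosets r q x y
    Cosets-reflexive {x} {y} σ≗τ a≗b = Cosets-intro {x} {y} 0ℤ σ≗τ λ i →
      trans (a≗b i) (sym (ℤP.+-identityʳ (expo y i)))

    Cosets-sym : ∀ {x y : Mon n} → Cosets r q x y → Cosets r q y x
    Cosets-sym {x} {y} (σ≗τ , k , r∣) = (λ i → sym (σ≗τ i)) , - k , λ i →
      subst (+ r ∣_) (negate (expo x i) (expo y i) k D) (∣m⇒∣-m (r∣ i))
      where
      negate : ∀ a b k d → - (a - (b + k * d)) ≡ b - (a + - k * d)
      negate a b k d = solve (a ∷ b ∷ k ∷ d ∷ [])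

    Cosets-trans : ∀ {x y z : Mon n} → Cosets r q x y → Cosets r q y z → Cosets r q x z
    Cosets-trans {x} {y} {z} (σ≗τ , k , r∣) (τ≗υ , l , r∣′) = (λ i → trans (σ≗τ i) (τ≗υ i)) , k + l , λ i →
      subst (+ r ∣_) (add (expo x i) (expo y i) (expo z i) k l D) (∣m∣n⇒∣m+n (r∣ i) (r∣′ i))
      where
      add : ∀ a b c k l d → (a - (b + k * d)) + (b - (c + l * d)) ≡ a - (c + (k + l) * d)
      add a b c k l d = solve (a ∷ b ∷ c ∷ k ∷ l ∷ d ∷ [])

    Cosets-setoid : Setoid 0ℓ 0ℓ
    Cosets-setoid = record
      { Carrier       = Mon n
      ; _≈_           = Cosets r q
      ; isEquivalence = record
        { refl  = λ {x} → Cosets-reflexive {x} {x} (λ _ → refl) (λ _ → refl)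
        ; sym   = λ {x} {y} → Cosets-sym {x} {y}
        ; trans = λ {x} {y} {z} → Cosets-trans {x} {y} {z}
        }
      }

    ∣-sum-Cosets : ∀ {x y : Mon n} {e} → (∀ i → + r ∣ expo x i - (expo y i + e)) →
                   + r ∣ sum (expo x) - (sum (expo y) + + n * e)
    ∣-sum-Cosets {x} {y} {e} r∣ = subst (+ r ∣_)
      (trans (sum-difference (expo x) (expo (shift e y))) (cong (_-_ (sum (expo x))) (sum-expo-shift e y)))
      (∣-sum (λ i → expo x i - expo (shift e y) i) r∣)

    shift-Cosets : ∀ {x y : Mon n} e c d k → (∀ i → perm x ⟨$⟩ʳ i ≡ perm y ⟨$⟩ʳ i) →
                   (∀ i → + r ∣ expo x i - (expo y i + e)) → k * D ≡ e + c - d →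
                   Cosets r q (shift c x) (shift d y)
    shift-Cosets {x} {y} e c d k σ≗τ r∣ kD≡e+c-d = σ≗τ , k , λ i → subst (+ r ∣_) (sym (begin
      (expo x i + c) - ((expo y i + d) + k * D)       ≡⟨ cong (λ t → (expo x i + c) - ((expo y i + d) + t)) kD≡e+c-d ⟩
      (expo x i + c) - ((expo y i + d) + (e + c - d)) ≡⟨ cancel (expo x i) (expo y i) ⟩
      expo x i - (expo y i + e)                       ∎)) (r∣ i)
      where
      cancel : ∀ a b → (a + c) - ((b + d) + (e + c - d)) ≡ a - (b + e)
      cancel a b = solve (a ∷ b ∷ c ∷ d ∷ e ∷ [])

  +[m/n]*+n≡+m : ∀ {m n} .{{_ : NonZero n}} → n ∣ℕ m → + (m / n) * + n ≡ + m
  +[m/n]*+n≡+m {m} {n} n∣m = trans (sym (ℤP.pos-* (m / n) n)) (cong +_ (m/n*n≡m n∣m))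

  module Degree {r p : ℕ} .{{_ : NonZero r}} .{{_ : NonZero p}} (p∣r : p ∣ℕ r) {n : ℕ} where

    private
      E = + (r / p)
      instance
        r/p≢0 : NonZero (r / p)
        r/p≢0 = ℕ.>-nonZero (m≥n⇒m/n>0 (ℕ∣.∣⇒≤ p∣r))

    InG⇒∣sum : ∀ {x : Mon n} → InG r p x → + p ∣ sum (expo x)
    InG⇒∣sum {x} h = *-cancelˡ-∣ E (subst (_∣ E * sum (expo x)) (sym (+[m/n]*+n≡+m p∣r)) h)

    ∣sum⇒InG : ∀ {x : Mon n} → + p ∣ sum (expo x) → InG r p x
    ∣sum⇒InG {x} h = subst (_∣ E * sum (expo x)) (+[m/n]*+n≡+m p∣r) (*-monoʳ-∣ E h)

    deg : Σ (Mon n) (InG r p) → ℤ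
    deg (x , h) = quotient (InG⇒∣sum {x} h)

    sum≡deg*p : ∀ x → sum (expo (proj₁ x)) ≡ deg x * + p
    sum≡deg*p (x , h) = _∣_.equality (InG⇒∣sum {x} h)

    deg-unique : ∀ x {j} → sum (expo (proj₁ x)) ≡ j * + p → deg x ≡ j
    deg-unique x {j} s≡jp = ℤP.*-cancelʳ-≡ (deg x) j (+ p) (trans (sym (sum≡deg*p x)) s≡jp)

    deg-· : ∀ x y (h : InG r p (proj₁ x · proj₁ y)) → deg (proj₁ x · proj₁ y , h) ≡ deg x + deg y
    deg-· x y h = deg-unique (proj₁ x · proj₁ y , h) (begin
      sum (expo (proj₁ x · proj₁ y))              ≡⟨ sum-expo-· (proj₁ x) (proj₁ y) ⟩
      sum (expo (proj₁ x)) + sum (expo (proj₁ y)) ≡⟨ cong₂ _+_ (sum≡deg*p x) (sum≡deg*p y) ⟩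
      deg x * + p + deg y * + p                   ≡⟨ ℤP.*-distribʳ-+ (+ p) (deg x) (deg y) ⟨
      (deg x + deg y) * + p                       ∎)

    deg-inv : ∀ x (h : InG r p (inv (proj₁ x))) → deg (inv (proj₁ x) , h) ≡ - deg x
    deg-inv x h = deg-unique (inv (proj₁ x) , h) (begin
      sum (expo (inv (proj₁ x))) ≡⟨ sum-expo-inv (proj₁ x) ⟩
      - sum (expo (proj₁ x))     ≡⟨ cong -_ (sum≡deg*p x) ⟩
      - (deg x * + p)            ≡⟨ ℤP.neg-distribˡ-* (deg x) (+ p) ⟩
      - deg x * + p              ∎)

    deg-one : ∀ (h : InG r p (one {n})) → deg (one , h) ≡ 0ℤ
    deg-one h = deg-unique (one , h) (trans (sum-replicate-zero n) (sym (ℤP.*-zeroˡ (+ p))))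

  cofactor-exchange : ∀ D D′ P P′ Q Q′ {R} .{{_ : ℤ.NonZero Q′}} →
                      D * Q ≡ R → D′ * Q′ ≡ R → P * Q ≡ P′ * Q′ → D * P′ ≡ P * D′
  cofactor-exchange D D′ P P′ Q Q′ DQ≡R D′Q′≡R PQ≡P′Q′ = ℤP.*-cancelʳ-≡ _ _ Q′ (begin
    D * P′ * Q′   ≡⟨ ℤP.*-assoc D P′ Q′ ⟩
    D * (P′ * Q′) ≡⟨ cong (D *_) PQ≡P′Q′ ⟨
    D * (P * Q)   ≡⟨ solve (D ∷ P ∷ Q ∷ []) ⟩
    P * (D * Q)   ≡⟨ cong (P *_) (trans DQ≡R (sym D′Q′≡R)) ⟩
    P * (D′ * Q′) ≡⟨ ℤP.*-assoc P D′ Q′ ⟨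
    P * D′ * Q′   ∎)

  cofactor-divides : ∀ D′ Q′ R N M P′ .{{_ : ℤ.NonZero Q′}} →
                     D′ * Q′ ≡ R → R * N ≡ M * (P′ * Q′) → D′ * N ≡ P′ * M
  cofactor-divides D′ Q′ R N M P′ D′Q′≡R RN≡MP′Q′ = ℤP.*-cancelʳ-≡ _ _ Q′ (begin
    D′ * N * Q′   ≡⟨ solve (D′ ∷ N ∷ Q′ ∷ []) ⟩
    D′ * Q′ * N   ≡⟨ cong (_* N) D′Q′≡R ⟩
    R * N         ≡⟨ RN≡MP′Q′ ⟩
    M * (P′ * Q′) ≡⟨ solve (M ∷ P′ ∷ Q′ ∷ []) ⟩
    P′ * M * Q′   ∎)

  shifted-sum : ∀ P P′ N D v X j → P′ * X ≡ P + N * D * v →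
                j * P + N * (D * v * j) ≡ X * j * P′
  shifted-sum P P′ N D v X j P′X≡P+NDv = begin
    j * P + N * (D * v * j) ≡⟨ solve (j ∷ P ∷ N ∷ D ∷ v ∷ []) ⟩
    j * (P + N * D * v)     ≡⟨ cong (j *_) P′X≡P+NDv ⟨
    j * (P′ * X)            ≡⟨ solve (j ∷ P′ ∷ X ∷ []) ⟩
    X * j * P′              ∎

  coset-coefficient : ∀ P P′ D D′ E′ R N X v k m a b .{{_ : ℤ.NonZero P}} →
    E′ * P′ ≡ R → D * P′ ≡ P * D′ → P′ * X ≡ P + N * D * v →
    a * P - (b * P + N * (k * D)) ≡ m * R →
    (k * X + E′ * v * m) * D′ ≡ k * D + D * v * a - D * v * b
  coset-coefficient P P′ D D′ E′ R N X v k m a b E′P′≡R DP′≡PD′ P′X≡P+NDv sums =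
    ℤP.*-cancelˡ-≡ P _ _ (begin
      P * ((k * X + E′ * v * m) * D′)
        ≡⟨ solve (P ∷ k ∷ X ∷ E′ ∷ v ∷ m ∷ D′ ∷ []) ⟩
      (P * D′) * (k * X + E′ * v * m)
        ≡⟨ cong (_* (k * X + E′ * v * m)) DP′≡PD′ ⟨
      (D * P′) * (k * X + E′ * v * m)
        ≡⟨ solve (D ∷ P′ ∷ k ∷ X ∷ E′ ∷ v ∷ m ∷ []) ⟩
      D * k * (P′ * X) + D * v * (m * (E′ * P′))
        ≡⟨ cong₂ (λ s t → D * k * s + D * v * (m * t)) P′X≡P+NDv E′P′≡R ⟩
      D * k * (P + N * D * v) + D * v * (m * R)
        ≡⟨ cong (λ t → D * k * (P + N * D * v) + D * v * t) sums ⟨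
      D * k * (P + N * D * v) + D * v * (a * P - (b * P + N * (k * D)))
        ≡⟨ solve (D ∷ k ∷ P ∷ N ∷ v ∷ a ∷ b ∷ []) ⟩
      P * (k * D + D * v * a - D * v * b)
        ∎)

  round-trip-shift : ∀ P P′ D D′ N M v v′ X j .{{_ : ℤ.NonZero P′}} →
    P′ * X ≡ P + N * D * v → D′ * P ≡ P′ * D → D′ * N ≡ P′ * M →
    D * v * j + D′ * v′ * (X * j) ≡ j * (v + v′ + M * v * v′) * D
  round-trip-shift P P′ D D′ N M v v′ X j P′X≡P+NDv D′P≡P′D D′N≡P′M = begin
    D * v * j + D′ * v′ * (X * j)       ≡⟨ solve (D ∷ v ∷ j ∷ D′ ∷ v′ ∷ X ∷ []) ⟩
    D * v * j + (D′ * v′ * X) * j       ≡⟨ cong (λ t → D * v * j + t * j) D′v′X≡D[v′+Mvv′] ⟩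
    D * v * j + D * (v′ + M * v * v′) * j ≡⟨ solve (D ∷ v ∷ j ∷ v′ ∷ M ∷ []) ⟩
    j * (v + v′ + M * v * v′) * D       ∎
    where
    D′v′X≡D[v′+Mvv′] : D′ * v′ * X ≡ D * (v′ + M * v * v′)
    D′v′X≡D[v′+Mvv′] = ℤP.*-cancelˡ-≡ P′ _ _ (begin
      P′ * (D′ * v′ * X)                        ≡⟨ solve (P′ ∷ D′ ∷ v′ ∷ X ∷ []) ⟩
      D′ * v′ * (P′ * X)                        ≡⟨ cong (D′ * v′ *_) P′X≡P+NDv ⟩
      D′ * v′ * (P + N * D * v)                 ≡⟨ solve (D′ ∷ v′ ∷ P ∷ N ∷ D ∷ v ∷ []) ⟩
      (D′ * P) * v′ + (D′ * N) * D * v * v′     ≡⟨ cong₂ (λ s t → s * v′ + t * D * v * v′) D′P≡P′D D′N≡P′M ⟩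
      (P′ * D) * v′ + (P′ * M) * D * v * v′     ≡⟨ solve (P′ ∷ D ∷ v′ ∷ M ∷ v ∷ []) ⟩
      P′ * (D * (v′ + M * v * v′))              ∎)

  pos-linear : ∀ a b c d e → a ℕ.+ b ℕ.* c ≡ d ℕ.* e → + a + + b * + c ≡ + d * + e
  pos-linear a b c d e a+bc≡de = begin
    + a + + b * + c     ≡⟨ cong (_+_ (+ a)) (ℤP.pos-* b c) ⟨
    + a + + (b ℕ.* c)   ≡⟨ ℤP.pos-+ a (b ℕ.* c) ⟨
    + (a ℕ.+ b ℕ.* c)   ≡⟨ cong +_ a+bc≡de ⟩
    + (d ℕ.* e)         ≡⟨ ℤP.pos-* d e ⟩
    + d * + e           ∎

  isolate : ∀ g y n x m → g + y * n ≡ x * m → g ≡ x * m + - y * n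
  isolate g y n x m g+yn≡xm = begin
    g                     ≡⟨ solve (g ∷ y ∷ n ∷ []) ⟩
    (g + y * n) - y * n   ≡⟨ cong (_- y * n) g+yn≡xm ⟩
    x * m - y * n         ≡⟨ cong (_+_ (x * m)) (ℤP.neg-distribˡ-* y n) ⟩
    x * m + - y * n       ∎

  gcd-linear-combination : ∀ m n → ∃₂ λ x y → + gcd m n ≡ x * + m + y * + n
  gcd-linear-combination m n with Bézout.identity (gcd-GCD m n)
  ... | Bézout.+- x y g+yn≡xm =
    + x , - + y , isolate (+ gcd m n) (+ y) (+ n) (+ x) (+ m) (pos-linear (gcd m n) y n x m g+yn≡xm)
  ... | Bézout.-+ x y g+xm≡yn =
    - + x , + y , trans (isolate (+ gcd m n) (+ x) (+ m) (+ y) (+ n) (pos-linear (gcd m n) x m y n g+xm≡yn))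
                        (ℤP.+-comm (+ y * + n) (- + x * + m))

  gcd∣⇒linear-combination : ∀ N p p′ → gcd N p′ ∣ℕ p → ∃₂ λ v X → + p′ * X ≡ + p + + N * v
  gcd∣⇒linear-combination N p p′ (ℕ∣.divides c p≡cg) with gcd-linear-combination N p′
  ... | x , y , g≡xN+yp′ = - (+ c * x) , + c * y , (begin
    + p′ * (+ c * y)                      ≡⟨ scale (+ c) (+ gcd N p′) x y (+ N) (+ p′) g≡xN+yp′ ⟩
    + c * + gcd N p′ + + N * - (+ c * x)  ≡⟨ cong (_+ + N * - (+ c * x)) c*g≡p ⟩
    + p + + N * - (+ c * x)               ∎)
    where
    c*g≡p : + c * + gcd N p′ ≡ + p
    c*g≡p = trans (sym (ℤP.pos-* c (gcd N p′))) (cong +_ (sym p≡cg))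
    scale : ∀ C G x y A B → G ≡ x * A + y * B → B * (C * y) ≡ C * G + A * - (C * x)
    scale C G x y A B G≡xA+yB = begin
      B * (C * y)                    ≡⟨ solve (B ∷ C ∷ y ∷ x ∷ A ∷ []) ⟩
      C * (x * A + y * B) + A * - (C * x) ≡⟨ cong (λ t → C * t + A * - (C * x)) G≡xA+yB ⟨
      C * G + A * - (C * x)          ∎

  module Transfer (r n p q p′ q′ : ℕ) .{{_ : NonZero r}} .{{_ : NonZero p}} .{{_ : NonZero q}}
                  .{{_ : NonZero p′}} .{{_ : NonZero q′}}
                  (p∣r : p ∣ℕ r) (q∣r : q ∣ℕ r) (p′∣r : p′ ∣ℕ r) (q′∣r : q′ ∣ℕ r)
                  (pq≡p′q′ : p ℕ.* q ≡ p′ ℕ.* q′)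
                  {v X : ℤ} (p′X≡p+[rn/q]v : + p′ * X ≡ + p + + ((r ℕ.* n) / q) * v) where

    private
      module G₁ = RawGroup (G r n p q)
      module G₂ = RawGroup (G r n p′ q′)
      D  = + (r / q)
      D′ = + (r / q′)

    open Degree p∣r {n} public
    open Degree p′∣r {n} using () renaming (deg to deg′; deg-unique to deg′-unique; ∣sum⇒InG to ∣sum⇒InG′)

    p′X≡p+nDv : + p′ * X ≡ + p + + n * D * v
    p′X≡p+nDv = trans p′X≡p+[rn/q]v (cong (λ t → + p + t * v) [rn/q]≡n*[r/q])
      where
      [rn/q]≡n*[r/q] : + ((r ℕ.* n) / q) ≡ + n * D
      [rn/q]≡n*[r/q] = trans (cong +_ (trans (cong (_/ q) (ℕP.*-comm r n)) (*-/-assoc n q∣r)))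
                             (ℤP.pos-* n (r / q))

    Dp′≡pD′ : D * + p′ ≡ + p * D′
    Dp′≡pD′ = cofactor-exchange D D′ (+ p) (+ p′) (+ q) (+ q′) (+[m/n]*+n≡+m q∣r) (+[m/n]*+n≡+m q′∣r)
      (trans (sym (ℤP.pos-* p q)) (trans (cong +_ pq≡p′q′) (ℤP.pos-* p′ q′)))

    φ₀ : G₁.Carrier → Mon n
    φ₀ x = shift (D * v * deg x) (proj₁ x)

    sum-φ₀ : ∀ x → sum (expo (φ₀ x)) ≡ X * deg x * + p′
    sum-φ₀ x = begin
      sum (expo (φ₀ x))                            ≡⟨ sum-expo-shift (D * v * deg x) (proj₁ x) ⟩
      sum (expo (proj₁ x)) + + n * (D * v * deg x) ≡⟨ cong (_+ + n * (D * v * deg x)) (sum≡deg*p x) ⟩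
      deg x * + p + + n * (D * v * deg x)          ≡⟨ shifted-sum (+ p) (+ p′) (+ n) D v X (deg x) p′X≡p+nDv ⟩
      X * deg x * + p′                             ∎

    φ : G₁.Carrier → G₂.Carrier
    φ x = φ₀ x , ∣sum⇒InG′ {φ₀ x} (divides (X * deg x) (sum-φ₀ x))

    deg′-φ : ∀ x → deg′ (φ x) ≡ X * deg x
    deg′-φ x = deg′-unique (φ x) {X * deg x} (sum-φ₀ x)

    φ-cong : ∀ {x y} → x G₁.≈ y → φ x G₂.≈ φ y
    -- Summing the congruences of x ≈ y over all coordinates gives
    -- p·(deg x − deg y) ≡ n·k·(r/q) (mod r), which is what makes kX + (r/p′)·v·m
    -- a multiplier for φ x ≈ φ y.
    φ-cong {x} {y} (σ≗τ , k , r∣) =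
      shift-Cosets {q = q′} {x = proj₁ x} {proj₁ y} (k * D) (D * v * deg x) (D * v * deg y)
                   (k * X + + (r / p′) * v * m) σ≗τ r∣
        (coset-coefficient (+ p) (+ p′) D D′ (+ (r / p′)) (+ r) (+ n) X v k m (deg x) (deg y)
           (+[m/n]*+n≡+m p′∣r) Dp′≡pD′ p′X≡p+nDv sums)
      where
      r∣sums : + r ∣ sum (expo (proj₁ x)) - (sum (expo (proj₁ y)) + + n * (k * D))
      r∣sums = ∣-sum-Cosets {q = q} {x = proj₁ x} {proj₁ y} r∣
      m = quotient r∣sums
      sums : deg x * + p - (deg y * + p + + n * (k * D)) ≡ m * + r
      sums = trans (cong₂ (λ s t → s - (t + + n * (k * D))) (sym (sum≡deg*p x)) (sym (sum≡deg*p y)))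
                   (_∣_.equality r∣sums)

    φ-homo : ∀ x y → φ (x G₁.∙ y) G₂.≈ (φ x G₂.∙ φ y)
    φ-homo x y = Cosets-reflexive {q = q′} {x = φ₀ (x G₁.∙ y)} {φ₀ x · φ₀ y} (λ _ → refl) λ i → begin
      expo (shift (D * v * deg (x G₁.∙ y)) (proj₁ x · proj₁ y)) i
        ≡⟨ cong (λ j → expo (shift (D * v * j) (proj₁ x · proj₁ y)) i) (deg-· x y (proj₂ (x G₁.∙ y))) ⟩
      expo (shift (D * v * (deg x + deg y)) (proj₁ x · proj₁ y)) i
        ≡⟨ cong (λ c → expo (shift c (proj₁ x · proj₁ y)) i) (ℤP.*-distribˡ-+ (D * v) (deg x) (deg y)) ⟩
      expo (shift (D * v * deg x + D * v * deg y) (proj₁ x · proj₁ y)) i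
        ≡⟨ shift-· (D * v * deg x) (D * v * deg y) (proj₁ x) (proj₁ y) i ⟩
      expo (φ₀ x · φ₀ y) i ∎

    φ-ε : φ G₁.ε G₂.≈ G₂.ε
    φ-ε = Cosets-reflexive {q = q′} {x = φ₀ G₁.ε} {one} (λ _ → refl) λ i → begin
      expo (shift (D * v * deg G₁.ε) one) i
        ≡⟨ cong (λ j → expo (shift (D * v * j) one) i) (deg-one (proj₂ G₁.ε)) ⟩
      expo (shift (D * v * 0ℤ) one) i
        ≡⟨ cong (λ c → expo (shift c one) i) (ℤP.*-zeroʳ (D * v)) ⟩
      expo (shift 0ℤ one) i
        ≡⟨ shift-zero one i ⟩
      expo one i ∎

    φ-⁻¹ : ∀ x → φ (x G₁.⁻¹) G₂.≈ (φ x G₂.⁻¹)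
    φ-⁻¹ x = Cosets-reflexive {q = q′} {x = φ₀ (x G₁.⁻¹)} {inv (φ₀ x)} (λ _ → refl) λ i → begin
      expo (shift (D * v * deg (x G₁.⁻¹)) (inv (proj₁ x))) i
        ≡⟨ cong (λ j → expo (shift (D * v * j) (inv (proj₁ x))) i) (deg-inv x (proj₂ (x G₁.⁻¹))) ⟩
      expo (shift (D * v * - deg x) (inv (proj₁ x))) i
        ≡⟨ cong (λ c → expo (shift c (inv (proj₁ x))) i) (ℤP.neg-distribʳ-* (D * v) (deg x)) ⟨
      expo (shift (- (D * v * deg x)) (inv (proj₁ x))) i
        ≡⟨ shift-inv (D * v * deg x) (proj₁ x) i ⟩
      expo (inv (φ₀ x)) i ∎

    isGroupHomomorphism : GroupMorphisms.IsGroupHomomorphism (G r n p q) (G r n p′ q′) φ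
    isGroupHomomorphism = record
      { isMonoidHomomorphism = record
        { isMagmaHomomorphism = record
          { isRelHomomorphism = record { cong = λ {x} {y} → φ-cong {x} {y} }
          ; homo              = φ-homo
          }
        ; ε-homo = φ-ε
        }
      ; ⁻¹-homo = φ-⁻¹
      }

  module RoundTrip (r n p q p′ q′ : ℕ) .{{_ : NonZero r}} .{{_ : NonZero p}} .{{_ : NonZero q}}
                   .{{_ : NonZero p′}} .{{_ : NonZero q′}}
                   (p∣r : p ∣ℕ r) (q∣r : q ∣ℕ r) (p′∣r : p′ ∣ℕ r) (q′∣r : q′ ∣ℕ r)
                   (pq≡p′q′ : p ℕ.* q ≡ p′ ℕ.* q′) (p′q′∣rn : p′ ℕ.* q′ ∣ℕ r ℕ.* n)
                   {v X : ℤ} (p′X≡p+[rn/q]v : + p′ * X ≡ + p + + ((r ℕ.* n) / q) * v)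
                   {v′ X′ : ℤ} (pX′≡p′+[rn/q′]v′ : + p * X′ ≡ + p′ + + ((r ℕ.* n) / q′) * v′) where

    module Φ = Transfer r n p q p′ q′ p∣r q∣r p′∣r q′∣r pq≡p′q′ p′X≡p+[rn/q]v
    module Ψ = Transfer r n p′ q′ p q p′∣r q′∣r p∣r q∣r (sym pq≡p′q′) pX′≡p′+[rn/q′]v′

    private
      D  = + (r / q)
      D′ = + (r / q′)
      m  = ℕ∣._∣_.quotient p′q′∣rn
      M  = + m

      D′n≡p′M : D′ * + n ≡ + p′ * M
      D′n≡p′M = cofactor-divides D′ (+ q′) (+ r) (+ n) M (+ p′) (+[m/n]*+n≡+m q′∣r) (begin
        + r * + n                  ≡⟨ ℤP.pos-* r n ⟨
        + (r ℕ.* n)                ≡⟨ cong +_ (ℕ∣._∣_.equality p′q′∣rn) ⟩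
        + (m ℕ.* (p′ ℕ.* q′))      ≡⟨ ℤP.pos-* m (p′ ℕ.* q′) ⟩
        M * + (p′ ℕ.* q′)          ≡⟨ cong (M *_) (ℤP.pos-* p′ q′) ⟩
        M * (+ p′ * + q′)          ∎)

    ψ∘φ≈id : ∀ x → Cosets r q (proj₁ (Ψ.φ (Φ.φ x))) (proj₁ x)
    ψ∘φ≈id x = Cosets-intro {q = q} {x = proj₁ (Ψ.φ (Φ.φ x))} {proj₁ x} (j * (v + v′ + M * v * v′))
      (λ _ → refl) λ i → begin
        expo (shift (D′ * v′ * Ψ.deg (Φ.φ x)) (shift (D * v * j) (proj₁ x))) i
          ≡⟨ shift-shift (D * v * j) (D′ * v′ * Ψ.deg (Φ.φ x)) (proj₁ x) i ⟩
        expo (proj₁ x) i + (D * v * j + D′ * v′ * Ψ.deg (Φ.φ x))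
          ≡⟨ cong (λ t → expo (proj₁ x) i + (D * v * j + D′ * v′ * t)) (Φ.deg′-φ x) ⟩
        expo (proj₁ x) i + (D * v * j + D′ * v′ * (X * j))
          ≡⟨ cong (_+_ (expo (proj₁ x) i))
                  (round-trip-shift (+ p) (+ p′) D D′ (+ n) M v v′ X j Φ.p′X≡p+nDv Ψ.Dp′≡pD′ D′n≡p′M) ⟩
        expo (proj₁ x) i + j * (v + v′ + M * v * v′) * D ∎
      where
      j = Φ.deg x

open Monomial
open import Data.Nat using (ℕ; NonZero; _*_)
open import Data.Nat.DivMod using (_/_)
open import Data.Nat.Divisibility using (_∣_)
open import Data.Nat.GCD using (gcd; gcd[m,n]∣n)
open import Data.Product using (∃; _,_; proj₁; proj₂)
open import Algebra.Bundles.Raw using (RawGroup)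
open import Algebra.Morphism.Structures using (module GroupMorphisms)
open import Relation.Binary.PropositionalEquality using (_≡_; sym; subst)
import Relation.Binary.Reasoning.Setoid as ≈-Reasoning

module Isomorphism (r n p q p′ q′ : ℕ) .{{_ : NonZero r}} .{{_ : NonZero p}} .{{_ : NonZero q}}
                   .{{_ : NonZero p′}} .{{_ : NonZero q′}}
                   (p∣r : p ∣ r) (q∣r : q ∣ r) (p′∣r : p′ ∣ r) (q′∣r : q′ ∣ r)
                   (pq≡p′q′ : p * q ≡ p′ * q′) (pq∣rn : (p * q) ∣ (r * n)) (p′q′∣rn : (p′ * q′) ∣ (r * n))
                   (gcd∣p : gcd ((r * n) / q) p′ ∣ p) (gcd∣p′ : gcd ((r * n) / q′) p ∣ p′) where

  private
    solution  = gcd∣⇒linear-combination ((r * n) / q) p p′ gcd∣p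
    solution′ = gcd∣⇒linear-combination ((r * n) / q′) p′ p gcd∣p′
    module forth = RoundTrip r n p q p′ q′ p∣r q∣r p′∣r q′∣r pq≡p′q′ p′q′∣rn
                             (proj₂ (proj₂ solution)) (proj₂ (proj₂ solution′))
    module back  = RoundTrip r n p′ q′ p q p′∣r q′∣r p∣r q∣r (sym pq≡p′q′) pq∣rn
                             (proj₂ (proj₂ solution′)) (proj₂ (proj₂ solution))
    open forth using (module Φ; module Ψ)
    module G₁ = RawGroup (G r n p q)
    module G₂ = RawGroup (G r n p′ q′)

  open Φ using (φ) public

  injective : ∀ {x y} → φ x G₂.≈ φ y → x G₁.≈ y
  injective {x} {y} φx≈φy = begin
    proj₁ x             ≈⟨ forth.ψ∘φ≈id x ⟨
    proj₁ (Ψ.φ (φ x))   ≈⟨ Ψ.φ-cong {φ x} {φ y} φx≈φy ⟩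
    proj₁ (Ψ.φ (φ y))   ≈⟨ forth.ψ∘φ≈id y ⟩
    proj₁ y             ∎
    where open ≈-Reasoning (Cosets-setoid {r} {q} {n})

  surjective : ∀ y → ∃ λ x → ∀ {z} → z G₁.≈ x → φ z G₂.≈ y
  surjective y = Ψ.φ y , λ {z} z≈ψy → begin
    proj₁ (φ z)         ≈⟨ Φ.φ-cong {z} {Ψ.φ y} z≈ψy ⟩
    proj₁ (φ (Ψ.φ y))   ≈⟨ back.ψ∘φ≈id y ⟩
    proj₁ y             ∎
    where open ≈-Reasoning (Cosets-setoid {r} {q′} {n})

  isGroupIsomorphism : GroupMorphisms.IsGroupIsomorphism (G r n p q) (G r n p′ q′) φ
  isGroupIsomorphism = record
    { isGroupMonomorphism = record
      { isGroupHomomorphism = Φ.isGroupHomomorphism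
      ; injective           = λ {x} {y} → injective {x} {y}
      }
    ; surjective = surjective
    }

proposition4p3 : (r n p q p′ q′ : ℕ)
    → .{{_ : NonZero r}} → .{{_ : NonZero n}}
    → .{{_ : NonZero p}} → .{{_ : NonZero q}}
    → .{{_ : NonZero p′}} → .{{_ : NonZero q′}}
    → p ∣ r → q ∣ r → (p * q) ∣ (r * n)
    → p′ ∣ r → q′ ∣ r → (p′ * q′) ∣ (r * n)
    → p * q ≡ p′ * q′
    → gcd ((r * n) / q) p′ ≡ gcd ((r * n) / q′) p
    → ∃ λ f → GroupMorphisms.IsGroupIsomorphism
                (G r n p q) (G r n p′ q′) f
proposition4p3 r n p q p′ q′ p∣r q∣r pq∣rn p′∣r q′∣r p′q′∣rn pq≡p′q′ gcd≡gcd′ =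
  φ , isGroupIsomorphism
  where
  open Isomorphism r n p q p′ q′ p∣r q∣r p′∣r q′∣r pq≡p′q′ pq∣rn p′q′∣rn
    (subst (_∣ p) (sym gcd≡gcd′) (gcd[m,n]∣n ((r * n) / q′) p))
    (subst (_∣ p′) gcd≡gcd′ (gcd[m,n]∣n ((r * n) / q) p′))
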